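{- In the VRPD-DSS mixed-integer linear program, for three pairwise different nodes $l \in C$, $i \in N_0$, $k \in N_+$, the variables $z_{lik}^{fd}$ can be eliminated (fixed to zero) for all tandems $f \in F$ and drones $d \in D$, without excluding any optimal solution, if there is no feasible drone operation with launch node $i$ and retrieval node $k$, or if $$\neg \exists\, (i,j,k)^v \in W_v,\ v \in V,\ l \neq j \ \text{ s.t. }\ e^v_{ijk} + \max\left( \tau^{\mathrm{T}}_{il} + \tau_{l}^{\mathrm{S,T}} + \tau^{\mathrm{T}}_{lk} - \tau^v_{ijk},\, 0\right) \cdot P^{\mathrm{H}}(0) \leq \epsilon E.$$
   Context: Setting: the vehicle routing problem with drones and drone speed selection (VRPD-DSS). $C$ is the set of customers; nodes $0$ and $c+1$ are the start and end depot; $N = \{0\}\cup C\cup\{c+1\}$, $N_0 = N\setminus\{c+1\}$ (departure nodes), $N_+ = N\setminus\{0\}$ (arrival nodes). A homogeneous fleet $F$ of truck-drone tandems is used, each truck $f$ carrying a set of drones $D$. A drone flight is a triple $(i,j,k)$ with launch node $i \in N_0$, drone-served customer $j$, and retrieval node $k \in N_+$; an operation $(i,j,k)^v$ is that flight performed at speed $v$ from a discrete speed set $V$. $W_v$ is the set of feasible operations at speed $v$ (pairwise distinct nodes, $j$ drone-eligible, and minimum energy consumption including unavoidable hovering does not exceed $\epsilon E$). $\tau^{\mathrm{T}}_{ab}$ is the truck travel time from node $a$ to node $b$, $\tau_l^{\mathrm{S,T}}$ the truck service time at customer $l$, $\tau^v_{ijk} = \tau^{\mathrm{D},v}_{ij}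 + \tau_j^{\mathrm{S,D}} + \tau^{\mathrm{D},v}_{jk}$ the duration of operation $(i,j,k)^v$ (drone flight times at speed $v$ plus drone service time at $j$), and $e^v_{ijk}$ its energy consumption (flight to $j$ carrying the package, hovering during service at $j$, and empty flight to $k$). $P^{\mathrm{H}}(0)$ is the drone's hovering power without package, $E$ the nominal battery energy and $\epsilon$ the maximum depth of discharge, so $\epsilon E$ is the maximum usable energy. The binary variable $z_{lik}^{fd}=1$ if drone $d$ of tandem $f$ performs a flight with launch node $i$ and retrieval node $k$ while truck $f$ visits customer $l$ in between (so the drone is in the air at $l$), and 0 otherwise. A drone waiting for its truck at the retrieval node hovers and consumes $P^{\mathrm{H}}(0)$ per time unit.
   Formalization: The truck and drone travel times, service times, energies $e^v_{ijk}$, hovering power, $E$ and $\epsilon$ are rational, as are the arrival, departure, launch and retrieval times of every solution considered. -}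

module Defs where

open import Data.Nat using (ℕ; suc; _<_; _≤_)
open import Data.Fin using (Fin; zero; fromℕ)
open import Data.Rational as ℚ using (ℚ; 0ℚ; _+_; _*_; _-_; _⊔_)
open import Data.List using (List)
open import Data.List.Membership.Propositional using (_∈_)
open import Data.Product using (Σ; _×_; ∃)
open import Data.Empty using (⊥)
open import Relation.Binary.PropositionalEquality using (_≡_; _≢_)

record Instance : Set₁ where
  field
    c    : ℕ                      -- number of customers
    nV   : ℕ                      -- number of speed levels, V = Fin nV
    nF   : ℕ                      -- number of tandems,  F = Fin nF
    nD   : ℕ                      -- drones per truck,   D = Fin nD
    eligible : Fin (suc (suc c)) → Set
    τT   : Fin (suc (suc c)) → Fin (suc (suc c)) → ℚ
    τST  : Fin (suc (suc c)) → ℚ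
    τD   : Fin nV → Fin (suc (suc c)) → Fin (suc (suc c)) → ℚ -- drone flight times at speed v
    τSD  : Fin (suc (suc c)) → ℚ
    e    : Fin nV → Fin (suc (suc c)) → Fin (suc (suc c)) → Fin (suc (suc c)) → ℚ
    PH0  : ℚ
    E    : ℚ
    ε    : ℚ                                             -- max depth of discharge
    PH0-nonneg   : 0ℚ ℚ.≤ PH0
    τST-nonneg   : ∀ a → 0ℚ ℚ.≤ τST a
    τT-triangle  : ∀ a b d → τT a d ℚ.≤ τT a b + τT b d

module _ (I : Instance) where
  open Instance I

  Node : Set
  Node = Fin (suc (suc c))

  depot₀ : Node
  depot₀ = zero

  depotₑ : Node
  depotₑ = fromℕ (suc c)

  Customer : Node → Set
  Customer j = j ≢ depot₀ × j ≢ depotₑ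

  InN₀ : Node → Set
  InN₀ i = i ≢ depotₑ

  InN₊ : Node → Set
  InN₊ k = k ≢ depot₀

  Speed : Set
  Speed = Fin nV

  τop : Speed → Node → Node → Node → ℚ
  τop v i j k = τD v i j + τSD j + τD v j k

  εE : ℚ
  εE = ε * E

  W : Speed → Node → Node → Node → Set
  W v i j k =
    InN₀ i × Customer j × InN₊ k ×
    i ≢ j × j ≢ k × i ≢ k ×
    eligible j × e v i j k ℚ.≤ εE

  record TruckSchedule : Set where
    field
      L    : ℕ
      pos  : ℕ → Node
      arr  : ℕ → ℚ
      dep  : ℕ → ℚ
      start : pos 0 ≡ depot₀
      end   : pos L ≡ depotₑ
      serve : ∀ p → p ≤ L → arr p + τST (pos p) ℚ.≤ dep p
      move  : ∀ p → p < L → dep p + τT (pos p) (pos (suc p)) ℚ.≤ arr (suc p)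

  -- A drone operation of a drone attached to a given truck schedule:
  -- launched at route position a (node i), retrieved at route position b (node k).
  record Flight (T : TruckSchedule) : Set where
    open TruckSchedule T
    field
      a b : ℕ
      a<b : a < b
      b≤L : b ≤ L
      j   : Node
      v   : Speed
      t₀  : ℚ                  -- launch time
      r   : ℚ                  -- retrieval time
      op-feasible : W v (pos a) j (pos b)
      launch-after  : arr a ℚ.≤ t₀
      launch-before : t₀ ℚ.≤ dep a
      retr-drone : t₀ + τop v (pos a) j (pos b) ℚ.≤ r
      retr-truck : arr b ℚ.≤ r
      retr-dep   : r ℚ.≤ dep b
      -- j is served by the drone, hence not visited by the truck
      j-not-truck : ∀ p → p ≤ L → pos p ≢ j
      -- energy: flight energy plus hovering while waiting at k
      energy : e v (pos a) j (pos b)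
               + (r - (t₀ + τop v (pos a) j (pos b))) * PH0 ℚ.≤ εE

  record Solution : Set where
    field
      truck   : Fin nF → TruckSchedule
      flights : (f : Fin nF) → Fin nD → List (Flight (truck f))

  -- z^{fd}_{lik} = 1
  z : Solution → Fin nF → Fin nD → Node → Node → Node → Set
  z S f d l i k =
    Σ (Flight (Solution.truck S f)) λ fl →
      fl ∈ Solution.flights S f d ×
      (TruckSchedule.pos (Solution.truck S f) (Flight.a fl) ≡ i) ×
      (TruckSchedule.pos (Solution.truck S f) (Flight.b fl) ≡ k) ×
      ∃ λ p → (Flight.a fl < p) × (p < Flight.b fl) ×
              (TruckSchedule.pos (Solution.truck S f) p ≡ l)

  NoOperation : Node → Node → Set
  NoOperation i k = ∀ v j → W v i j k → ⊥

  EnergyCriterion : Node → Node → Node → Set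
  EnergyCriterion l i k =
    (Σ Speed λ v → Σ Node λ j →
       W v i j k × l ≢ j ×
       e v i j k + ((τT i l + τST l + τT l k - τop v i j k) ⊔ 0ℚ) * PH0 ℚ.≤ εE)
    → ⊥

{-# OPTIONS --safe #-}
-- A flight launched at i and retrieved at k while its truck visits l is
-- retrieved only after the truck reaches k, at least τT i l + τST l + τT l k
-- after the launch (triangle inequality along the route).  The drone thus
-- hovers at k for at least max(τT i l + τST l + τT l k − τ^v_{ijk}, 0), so the
-- flight's own energy constraint is the inequality the criterion excludes.
module Submission where

open import Defs
open import Data.Fin using (Fin)
open import Data.Sum using (_⊎_; inj₁; inj₂)
open import Data.Product using (_,_)
open import Relation.Binary.PropositionalEquality using (_≢_; refl)
open import Relation.Nullary using (¬_)
open import Data.Nat as ℕ using (suc)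
import Data.Nat.Properties as ℕ
open import Data.Rational using (ℚ; 0ℚ; _+_; _*_; _-_; _⊔_; _≤_; NonNegative; nonNegative)
open import Data.Rational.Properties
open import Data.Rational.Solver using (module +-*-Solver)
open +-*-Solver using (solve; _:+_; _:-_; _:=_)

p+q≤r⇒q-s≤r-[p+s] : ∀ p q r s → p + q ≤ r → q - s ≤ r - (p + s)
p+q≤r⇒q-s≤r-[p+s] p q r s p+q≤r = begin
  q - s                ≡⟨ solve 3 (λ p q s → q :- s := (p :+ q) :- (p :+ s)) refl p q s ⟩
  (p + q) - (p + s)    ≤⟨ +-monoˡ-≤ _ p+q≤r ⟩
  r - (p + s)          ∎
  where open ≤-Reasoning

p≤q⇒0≤q-p : ∀ {p q} → p ≤ q → 0ℚ ≤ q - p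
p≤q⇒0≤q-p {p} {q} p≤q = begin
  0ℚ       ≡⟨ +-inverseʳ p ⟨
  p - p    ≤⟨ +-monoˡ-≤ _ p≤q ⟩
  q - p    ∎
  where open ≤-Reasoning

detour : (I : Instance) → Node I → Node I → Node I → ℚ
detour I i l k = τT i l + τST l + τT l k
  where open Instance I

module _ {I : Instance} (T : TruckSchedule I) where
  open Instance I
  open TruckSchedule T

  arr≤dep : ∀ {p} → p ℕ.≤ L → arr p ≤ dep p
  arr≤dep {p} p≤L = begin
    arr p                ≡⟨ +-identityʳ (arr p) ⟨
    arr p + 0ℚ           ≤⟨ +-monoʳ-≤ (arr p) (τST-nonneg (pos p)) ⟩
    arr p + τST (pos p)  ≤⟨ serve p p≤L ⟩
    dep p                ∎
    where open ≤-Reasoning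

  dep+τT≤arr : ∀ {p q} → p ℕ.< q → q ℕ.≤ L → dep p + τT (pos p) (pos q) ≤ arr q
  dep+τT≤arr {p} {suc q} p<1+q 1+q≤L with ℕ.m<1+n⇒m<n∨m≡n p<1+q
  ... | inj₂ refl = move p 1+q≤L
  ... | inj₁ p<q = begin
    dep p + τT (pos p) (pos (suc q))
      ≤⟨ +-monoʳ-≤ (dep p) (τT-triangle (pos p) (pos q) (pos (suc q))) ⟩
    dep p + (τT (pos p) (pos q) + τT (pos q) (pos (suc q)))
      ≡⟨ +-assoc (dep p) _ _ ⟨
    dep p + τT (pos p) (pos q) + τT (pos q) (pos (suc q))
      ≤⟨ +-monoˡ-≤ _ (dep+τT≤arr p<q q≤L) ⟩
    arr q + τT (pos q) (pos (suc q))
      ≤⟨ +-monoˡ-≤ _ (arr≤dep q≤L) ⟩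
    dep q + τT (pos q) (pos (suc q))
      ≤⟨ move q 1+q≤L ⟩
    arr (suc q) ∎
    where
    open ≤-Reasoning
    q≤L = ℕ.<⇒≤ 1+q≤L

  dep+detour≤arr : ∀ {a p b} → a ℕ.< p → p ℕ.< b → b ℕ.≤ L →
                   dep a + detour I (pos a) (pos p) (pos b) ≤ arr b
  dep+detour≤arr {a} {p} {b} a<p p<b b≤L = begin
    dep a + (τT (pos a) (pos p) + τST (pos p) + τT (pos p) (pos b))
      ≡⟨ solve 4 (λ x y z w → x :+ (y :+ z :+ w) := (x :+ y :+ z) :+ w) refl
                 (dep a) (τT (pos a) (pos p)) (τST (pos p)) (τT (pos p) (pos b)) ⟩
    dep a + τT (pos a) (pos p) + τST (pos p) + τT (pos p) (pos b)
      ≤⟨ +-monoˡ-≤ _ (+-monoˡ-≤ _ (dep+τT≤arr a<p p≤L)) ⟩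
    arr p + τST (pos p) + τT (pos p) (pos b)
      ≤⟨ +-monoˡ-≤ _ (serve p p≤L) ⟩
    dep p + τT (pos p) (pos b)
      ≤⟨ dep+τT≤arr p<b b≤L ⟩
    arr b ∎
    where
    open ≤-Reasoning
    p≤L = ℕ.<⇒≤ (ℕ.<-≤-trans p<b b≤L)

module _ {I : Instance} {T : TruckSchedule I} (fl : Flight I T) where
  open Instance I
  open TruckSchedule T
  open Flight fl

  private
    τ : ℚ
    τ = τop I v (pos a) j (pos b)

  waiting-time-bound : ∀ {p} → a ℕ.< p → p ℕ.< b →
                       (detour I (pos a) (pos p) (pos b) - τ) ⊔ 0ℚ ≤ r - (t₀ + τ)
  waiting-time-bound {p} a<p p<b = ⊔-lub
    (p+q≤r⇒q-s≤r-[p+s] t₀ X r τ (begin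
      t₀ + X      ≤⟨ +-monoˡ-≤ X launch-before ⟩
      dep a + X   ≤⟨ dep+detour≤arr T a<p p<b b≤L ⟩
      arr b       ≤⟨ retr-truck ⟩
      r           ∎))
    (p≤q⇒0≤q-p retr-drone)
    where
    open ≤-Reasoning
    X = detour I (pos a) (pos p) (pos b)

  energy-with-detour : ∀ {p} → a ℕ.< p → p ℕ.< b →
    e v (pos a) j (pos b) + ((detour I (pos a) (pos p) (pos b) - τ) ⊔ 0ℚ) * PH0 ≤ εE I
  energy-with-detour {p} a<p p<b = begin
    e v (pos a) j (pos b) + ((detour I (pos a) (pos p) (pos b) - τ) ⊔ 0ℚ) * PH0
      ≤⟨ +-monoʳ-≤ (e v (pos a) j (pos b)) (*-monoʳ-≤-nonNeg PH0 (waiting-time-bound a<p p<b)) ⟩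
    e v (pos a) j (pos b) + (r - (t₀ + τ)) * PH0
      ≤⟨ energy ⟩
    εE I ∎
    where
    open ≤-Reasoning
    instance
      PH0-nonNegative : NonNegative PH0
      PH0-nonNegative = nonNegative PH0-nonneg

-- The hypotheses on l, i, k only describe the index set of the MILP variables;
-- the argument does not need them.
proposition4 : (I : Instance) (l i k : Node I) →
    Customer I l → InN₀ I i → InN₊ I k →
    l ≢ i → l ≢ k → i ≢ k →
    (NoOperation I i k ⊎ EnergyCriterion I l i k) →
    (S : Solution I) (f : Fin (Instance.nF I)) (d : Fin (Instance.nD I)) →
    ¬ z I S f d l i k
proposition4 I l i k _ _ _ _ _ _ criterion S f d
             (fl , _ , refl , refl , p , a<p , p<b , refl) with criterion
... | inj₁ no-operation = no-operation v j op-feasible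
  where open Flight fl
... | inj₂ energy-criterion =
  energy-criterion (v , j , op-feasible , l≢j , energy-with-detour fl a<p p<b)
  where
  open Flight fl
  l≢j = j-not-truck p (ℕ.<⇒≤ (ℕ.<-≤-trans p<b b≤L))
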